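{- For all integers $a,b\geq 1$, the polynomial $\sum_{i\geq 0}\binom{2i}{i}\binom{a}{i}\binom{b}{i}t^i$ is the $f$-polynomial of a flag balanced simplicial complex.
   Context: For a $(d-1)$-dimensional simplicial complex with $f_i$ faces of dimension $i$ ($f_{ -1}=1$, counting the empty face), the $f$-polynomial is $\sum_{i=0}^{d}f_{i-1}t^i$. A simplicial complex is flag if all its minimal non-faces have two elements, and a $(d-1)$-dimensional complex is balanced if its vertices can be colored with $d$ colors so that the vertices of every face have distinct colors. -}

module Defs where

open import Data.Nat using (ℕ; zero; suc; _*_; _≡ᵇ_)
open import Data.Nat.Combinatorics using (_C_)
open import Data.Bool using (Bool; true; false; _∧_)
open import Data.Fin using (Fin)
open import Data.Fin.Subset using (Subset; outside; inside; _⊆_; _⊂_; _∈_; ∣_∣; ⊥)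
open import Data.Vec using ([]; _∷_)
open import Data.List using (List; [_]; map; _++_; filterᵇ; length)
open import Data.Product using (Σ; Σ-syntax; ∃; ∃-syntax; _×_)
open import Relation.Binary.PropositionalEquality using (_≡_)

allSubsets : (n : ℕ) → List (Subset n)
allSubsets zero = [ [] ]
allSubsets (suc n) = map (outside ∷_) (allSubsets n) ++ map (inside ∷_) (allSubsets n)

record SimplicialComplex (n : ℕ) : Set where
  field
    isFace    : Subset n → Bool
    emptyFace : isFace ⊥ ≡ true
    downClosed : ∀ {S T : Subset n} → S ⊆ T → isFace T ≡ true → isFace S ≡ true
open SimplicialComplex public

-- f_{i-1}: the number of faces with exactly i vertices
-- (the coefficient of t^i in the f-polynomial).
fCoeff : ∀ {n} → SimplicialComplex n → ℕ → ℕ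
fCoeff {n} K i = length (filterᵇ (λ S → isFace K S ∧ (∣ S ∣ ≡ᵇ i)) (allSubsets n))

IsMinimalNonFace : ∀ {n} → SimplicialComplex n → Subset n → Set
IsMinimalNonFace K S = isFace K S ≡ false × (∀ T → T ⊂ S → isFace K T ≡ true)

IsFlag : ∀ {n} → SimplicialComplex n → Set
IsFlag K = ∀ S → IsMinimalNonFace K S → ∣ S ∣ ≡ 2

-- Balanced: K has dimension d-1 (max face cardinality is d) and there is
-- a colouring of the vertices with d colours such that the vertices of
-- every face receive distinct colours.
IsBalanced : ∀ {n} → SimplicialComplex n → Set
IsBalanced {n} K =
  Σ[ d ∈ ℕ ]
    (∃[ F ] (isFace K F ≡ true × ∣ F ∣ ≡ d))
  × (∀ F → isFace K F ≡ true → Data.Nat._≤_ ∣ F ∣ d)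
  × (Σ[ κ ∈ (Fin n → Fin d) ] ∀ F → isFace K F ≡ true →
       ∀ x y → x ∈ F → y ∈ F → κ x ≡ κ y → x ≡ y)
  where import Data.Nat

coeff : ℕ → ℕ → ℕ → ℕ
coeff a b i = ((2 * i) C i) * (a C i) * (b C i)

-- The complex is the clique complex, hence flag, of a graph on the cells (x , y , s) of an
-- a × b grid carrying a tag s ∈ {false, true}: two cells are adjacent when they lie in different
-- rows and columns and, if their tags agree, the one in the later row lies in the later column.
-- Colouring by row (or by column) makes it balanced of dimension min(a, b) - 1. A face with i
-- vertices amounts to disjoint row sets R₀, R₁ and disjoint column sets C₀, C₁ with |R_s| = |C_s|
-- (the cells of tag s match R_s to C_s increasingly), so by Vandermonde's identity
--   f_{i-1} = Σ_{k+l=i} C(a,i) C(i,k) · C(b,i) C(i,l) = C(2i,i) C(a,i) C(b,i).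
-- Formally the faces are counted row by row: the cell of a face in its first row is the least
-- column of its tag class, which restricts the columns and tags available in the later rows.

module Submission where

open import Defs
open import Data.Bool using (Bool; true; false; _∧_; _∨_; not; _xor_; T; if_then_else_)
open import Data.Bool.Properties using (∧-comm; ∧-zeroʳ; ∧-identityʳ; xor-same)
open import Data.Empty using (⊥-elim)
open import Data.Fin using (Fin; zero; suc; fromℕ<; toℕ)
open import Data.Fin.Properties using (toℕ-fromℕ<)
open import Data.Fin.Subset using (Subset; inside; outside; _∈_; _⊆_; ∣_∣; ⁅_⁆; _∪_; ⊥)
open import Data.Fin.Subset.Properties
  using (x∈⁅x⁆; x∈⁅y⁆⇒x≡y; x∈p∪q⁺; x∈p∪q⁻; ∣⁅x⁆∣≡1; ∪-identityˡ; ∪-identityʳ; ⊆-antisym; _∈?_)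
open import Data.List using (List; []; _∷_; _++_; map; length; filterᵇ; lookup)
open import Data.Nat.ListAction using (sum)
open import Data.List.Membership.Propositional using (lose) renaming (_∈_ to _∈ₗ_)
open import Data.List.Membership.Propositional.Properties using (∈-++⁺ˡ; ∈-++⁺ʳ; ∈-map⁺; ∈-lookup)
open import Data.List.Properties using (length-++; filter-++; filter-some; filter-≐; filter-none)
open import Data.List.Relation.Unary.All as All using (All; []; _∷_)
import Data.List.Relation.Unary.All.Properties as Allₚ
open import Data.List.Relation.Unary.AllPairs using (AllPairs; []; _∷_)
import Data.List.Relation.Unary.AllPairs.Properties as AllPairsₚ
import Data.List.Relation.Unary.Any as Any
open import Data.List.Relation.Unary.Unique.Propositional using (Unique)
open import Data.Nat using (ℕ; zero; suc; _+_; _*_; _≤_; _<_; _≥_; _≤?_; _≡ᵇ_; _<ᵇ_; _⊓_; s≤s; z<s)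
open import Data.Nat.Properties
open import Data.Nat.Tactic.RingSolver using (solve-∀)
open import Data.Nat.Combinatorics using (_C_; nCk+nC[k+1]≡[n+1]C[k+1]; nCk≡nC[n∸k]; k>n⇒nCk≡0; nCn≡1)
open import Data.Product using (Σ-syntax; ∃-syntax; _×_; _,_; proj₁)
open import Data.Sum using (_⊎_; inj₁; inj₂)
open import Data.Vec using ([]; _∷_; here; there)
open import Function using (_∘_)
open import Relation.Nullary using (yes; no; ¬_)
open import Relation.Binary.Definitions using (tri<; tri≈; tri>)
open import Relation.Nullary.Decidable using (T?)
open import Relation.Binary.PropositionalEquality
import Algebra.Properties.CommutativeSemigroup +-commutativeSemigroup as +-CS

∧-elimˡ : ∀ {x y} → x ∧ y ≡ true → x ≡ true
∧-elimˡ {true} _ = refl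

∧-elimʳ : ∀ {x y} → x ∧ y ≡ true → y ≡ true
∧-elimʳ {true} e = e

module _ {A : Set} where

  filterᵇ-cong : ∀ {p q : A → Bool} xs → (∀ x → p x ≡ q x) → filterᵇ p xs ≡ filterᵇ q xs
  filterᵇ-cong {p} {q} xs e =
    filter-≐ (T? ∘ p) (T? ∘ q) ((λ {x} → subst T (e x)) , (λ {x} → subst T (sym (e x)))) xs

  filterᵇ-cong-All : ∀ {P : A → Set} {p q : A → Bool} {xs} → All P xs → (∀ {x} → P x → p x ≡ q x) →
    filterᵇ p xs ≡ filterᵇ q xs
  filterᵇ-cong-All [] eq = refl
  filterᵇ-cong-All {p = p} {q} {x ∷ xs} (px ∷ pxs) eq rewrite eq px with q x
  ... | true  = cong (x ∷_) (filterᵇ-cong-All pxs eq)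
  ... | false = filterᵇ-cong-All pxs eq

  filterᵇ-none : ∀ {p : A → Bool} {xs} → All (λ x → p x ≡ false) xs → filterᵇ p xs ≡ []
  filterᵇ-none {p} = filter-none (T? ∘ p) ∘ All.map (subst T)

  filterᵇ-filterᵇ : ∀ (p q : A → Bool) xs → filterᵇ p (filterᵇ q xs) ≡ filterᵇ (λ x → q x ∧ p x) xs
  filterᵇ-filterᵇ p q [] = refl
  filterᵇ-filterᵇ p q (x ∷ xs) with q x
  ... | false = filterᵇ-filterᵇ p q xs
  ... | true with p x
  ...   | true  = cong (x ∷_) (filterᵇ-filterᵇ p q xs)
  ...   | false = filterᵇ-filterᵇ p q xs

  filterᵇ-false : ∀ xs → filterᵇ (λ (_ : A) → false) xs ≡ []
  filterᵇ-false xs = filterᵇ-none (All.universal (λ _ → refl) xs)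

  length-filterᵇ-++ : ∀ (p : A → Bool) xs ys →
    length (filterᵇ p (xs ++ ys)) ≡ length (filterᵇ p xs) + length (filterᵇ p ys)
  length-filterᵇ-++ p xs ys = trans (cong length (filter-++ (T? ∘ p) xs ys)) (length-++ (filterᵇ p xs))

  length-filterᵇ-map : ∀ {B : Set} (p : B → Bool) (f : A → B) xs →
    length (filterᵇ p (map f xs)) ≡ length (filterᵇ (p ∘ f) xs)
  length-filterᵇ-map p f [] = refl
  length-filterᵇ-map p f (x ∷ xs) with p (f x)
  ... | true  = cong suc (length-filterᵇ-map p f xs)
  ... | false = length-filterᵇ-map p f xs

  filterᵇ-nonempty : ∀ (p : A → Bool) xs → 0 < length (filterᵇ p xs) → ∃[ x ] p x ≡ true
  filterᵇ-nonempty p (x ∷ xs) pos with p x in px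
  ... | true  = x , px
  ... | false = filterᵇ-nonempty p xs pos

  lookup-injective : ∀ {xs : List A} → Unique xs → ∀ {i j} → lookup xs i ≡ lookup xs j → i ≡ j
  lookup-injective (_ ∷ _) {zero} {zero} _ = refl
  lookup-injective (x∉xs ∷ _) {zero} {suc j} eq = ⊥-elim (All.lookup x∉xs (∈-lookup j) eq)
  lookup-injective (x∉xs ∷ _) {suc i} {zero} eq = ⊥-elim (All.lookup x∉xs (∈-lookup i) (sym eq))
  lookup-injective (_ ∷ u) {suc i} {suc j} eq = cong suc (lookup-injective u eq)

allSubsets-complete : ∀ {n} (S : Subset n) → S ∈ₗ allSubsets n
allSubsets-complete [] = Any.here refl
allSubsets-complete {suc n} (outside ∷ S) = ∈-++⁺ˡ (∈-map⁺ (outside ∷_) (allSubsets-complete S))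
allSubsets-complete {suc n} (inside ∷ S) =
  ∈-++⁺ʳ (map (outside ∷_) (allSubsets n)) (∈-map⁺ (inside ∷_) (allSubsets-complete S))

∣⁅x⁆∪⁅y⁆∣≡2 : ∀ {n} {x y : Fin n} → x ≢ y → ∣ ⁅ x ⁆ ∪ ⁅ y ⁆ ∣ ≡ 2
∣⁅x⁆∪⁅y⁆∣≡2 {x = zero} {zero} x≢y = ⊥-elim (x≢y refl)
∣⁅x⁆∪⁅y⁆∣≡2 {x = zero} {suc y} _ rewrite ∪-identityˡ ⁅ y ⁆ = cong suc (∣⁅x⁆∣≡1 y)
∣⁅x⁆∪⁅y⁆∣≡2 {x = suc x} {zero} _ rewrite ∪-identityʳ ⁅ x ⁆ = cong suc (∣⁅x⁆∣≡1 x)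
∣⁅x⁆∪⁅y⁆∣≡2 {x = suc x} {suc y} x≢y = ∣⁅x⁆∪⁅y⁆∣≡2 (x≢y ∘ cong suc)

module _ {n} (K : SimplicialComplex n) where

  fCoeff-pos⇒face : ∀ d → 0 < fCoeff K d → ∃[ F ] (isFace K F ≡ true × ∣ F ∣ ≡ d)
  fCoeff-pos⇒face d pos with filterᵇ-nonempty _ (allSubsets n) pos
  ... | F , e = F , ∧-elimˡ e , ≡ᵇ⇒≡ ∣ F ∣ d (subst T (sym (∧-elimʳ e)) _)

  face⇒fCoeff-pos : ∀ {F} → isFace K F ≡ true → 0 < fCoeff K ∣ F ∣
  face⇒fCoeff-pos {F} face = filter-some (T? ∘ _) (lose (allSubsets-complete F) counted)
    where
    counted : T (isFace K F ∧ (∣ F ∣ ≡ᵇ ∣ F ∣))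
    counted = subst (λ b → T (b ∧ (∣ F ∣ ≡ᵇ ∣ F ∣))) (sym face) (≡⇒≡ᵇ ∣ F ∣ ∣ F ∣ refl)

  fVector⇒isBalanced : ∀ d → 0 < fCoeff K d → (∀ j → d < j → fCoeff K j ≡ 0) →
    Σ[ κ ∈ (Fin n → Fin d) ] (∀ F → isFace K F ≡ true → ∀ x y → x ∈ F → y ∈ F → κ x ≡ κ y → x ≡ y) →
    IsBalanced K
  fVector⇒isBalanced d pos vanish colouring = d , fCoeff-pos⇒face d pos , bounded , colouring
    where
    bounded : ∀ F → isFace K F ≡ true → ∣ F ∣ ≤ d
    bounded F face with ∣ F ∣ ≤? d
    ... | yes ∣F∣≤d = ∣F∣≤d
    ... | no ∣F∣≰d = ⊥-elim (>⇒≢ (face⇒fCoeff-pos face) (vanish ∣ F ∣ (≰⇒> ∣F∣≰d)))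

-- Clique complexes

module CliqueComplex {L : Set} (compatible : L → L → Bool)
    (compatible-refl : ∀ u → compatible u u ≡ true)
    (compatible-sym : ∀ u v → compatible u v ≡ compatible v u) where

  -- Cliques whose vertices all satisfy allowed; recursing on the vertex list, allowed accumulates
  -- the neighbourhoods of the vertices already chosen.
  isClique : (L → Bool) → (ls : List L) → Subset (length ls) → Bool
  isClique allowed [] [] = true
  isClique allowed (l ∷ ls) (outside ∷ S) = isClique allowed ls S
  isClique allowed (l ∷ ls) (inside ∷ S) = allowed l ∧ isClique (λ v → allowed v ∧ compatible l v) ls S

  isClique-allowed : ∀ allowed ls S {i} → isClique allowed ls S ≡ true → i ∈ S →
    allowed (lookup ls i) ≡ true
  isClique-allowed allowed (l ∷ ls) (inside ∷ S) clique here = ∧-elimˡ clique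
  isClique-allowed allowed (l ∷ ls) (inside ∷ S) clique (there i∈S) =
    ∧-elimˡ (isClique-allowed _ ls S (∧-elimʳ clique) i∈S)
  isClique-allowed allowed (l ∷ ls) (outside ∷ S) clique (there i∈S) =
    isClique-allowed allowed ls S clique i∈S

  isClique-compatible : ∀ allowed ls S {i j} → isClique allowed ls S ≡ true → i ∈ S → j ∈ S →
    compatible (lookup ls i) (lookup ls j) ≡ true
  isClique-compatible allowed (l ∷ ls) (inside ∷ S) clique here here = compatible-refl l
  isClique-compatible allowed (l ∷ ls) (inside ∷ S) clique here (there j∈S) =
    ∧-elimʳ (isClique-allowed _ ls S (∧-elimʳ clique) j∈S)
  isClique-compatible allowed (l ∷ ls) (inside ∷ S) clique (there i∈S) here =
    trans (compatible-sym _ l) (∧-elimʳ (isClique-allowed _ ls S (∧-elimʳ clique) i∈S))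
  isClique-compatible allowed (l ∷ ls) (inside ∷ S) clique (there i∈S) (there j∈S) =
    isClique-compatible _ ls S (∧-elimʳ clique) i∈S j∈S
  isClique-compatible allowed (l ∷ ls) (outside ∷ S) clique (there i∈S) (there j∈S) =
    isClique-compatible allowed ls S clique i∈S j∈S

  isClique-witness : ∀ allowed ls S → isClique allowed ls S ≡ false →
    (∃[ i ] i ∈ S × allowed (lookup ls i) ≡ false) ⊎
    (∃[ i ] ∃[ j ] i ∈ S × j ∈ S × compatible (lookup ls i) (lookup ls j) ≡ false)
  isClique-witness allowed [] [] ()
  isClique-witness allowed (l ∷ ls) (outside ∷ S) nonclique with isClique-witness allowed ls S nonclique
  ... | inj₁ (i , i∈S , ¬a) = inj₁ (suc i , there i∈S , ¬a)
  ... | inj₂ (i , j , i∈S , j∈S , ¬c) = inj₂ (suc i , suc j , there i∈S , there j∈S , ¬c)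
  isClique-witness allowed (l ∷ ls) (inside ∷ S) nonclique with allowed l in al
  ... | false = inj₁ (zero , here , al)
  ... | true with isClique-witness _ ls S nonclique
  ...   | inj₂ (i , j , i∈S , j∈S , ¬c) = inj₂ (suc i , suc j , there i∈S , there j∈S , ¬c)
  ...   | inj₁ (i , i∈S , ¬a) with allowed (lookup ls i) in ai
  ...     | false = inj₁ (suc i , there i∈S , ai)
  ...     | true = inj₂ (zero , suc i , here , there i∈S , ¬a)

  isClique-intro : ∀ allowed ls S → (∀ {i} → i ∈ S → allowed (lookup ls i) ≡ true) →
    (∀ {i j} → i ∈ S → j ∈ S → compatible (lookup ls i) (lookup ls j) ≡ true) →
    isClique allowed ls S ≡ true
  isClique-intro allowed ls S allAllowed allCompatible with isClique allowed ls S in clique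
  ... | true = refl
  ... | false with isClique-witness allowed ls S clique
  ...   | inj₁ (i , i∈S , ¬a) = trans (sym ¬a) (allAllowed i∈S)
  ...   | inj₂ (i , j , i∈S , j∈S , ¬c) = trans (sym ¬c) (allCompatible i∈S j∈S)

  isClique-⊆ : ∀ allowed ls {S T} → S ⊆ T → isClique allowed ls T ≡ true → isClique allowed ls S ≡ true
  isClique-⊆ allowed ls {S} {T} S⊆T clique = isClique-intro allowed ls S
    (λ i∈S → isClique-allowed allowed ls T clique (S⊆T i∈S))
    (λ i∈S j∈S → isClique-compatible allowed ls T clique (S⊆T i∈S) (S⊆T j∈S))

  isClique-⊥ : ∀ allowed ls → isClique allowed ls ⊥ ≡ true
  isClique-⊥ allowed [] = refl
  isClique-⊥ allowed (l ∷ ls) = isClique-⊥ allowed ls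

  cliqueComplex : (ls : List L) → SimplicialComplex (length ls)
  cliqueComplex ls = record
    { isFace = isClique (λ _ → true) ls
    ; emptyFace = isClique-⊥ _ ls
    ; downClosed = isClique-⊆ _ ls
    }

  cliqueComplex-isFlag : ∀ ls → IsFlag (cliqueComplex ls)
  cliqueComplex-isFlag ls S (nonface , minimal) with isClique-witness _ ls S nonface
  ... | inj₁ (_ , _ , ())
  ... | inj₂ (i , j , i∈S , j∈S , incompatible) =
    trans (cong ∣_∣ (⊆-antisym S⊆P P⊆S)) (∣⁅x⁆∪⁅y⁆∣≡2 i≢j)
    where
    P = ⁅ i ⁆ ∪ ⁅ j ⁆
    i≢j : i ≢ j
    i≢j refl with () ← trans (sym incompatible) (compatible-refl (lookup ls i))
    P⊆S : P ⊆ S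
    P⊆S x∈P with x∈p∪q⁻ ⁅ i ⁆ ⁅ j ⁆ x∈P
    ... | inj₁ x∈⁅i⁆ rewrite x∈⁅y⁆⇒x≡y i x∈⁅i⁆ = i∈S
    ... | inj₂ x∈⁅j⁆ rewrite x∈⁅y⁆⇒x≡y j x∈⁅j⁆ = j∈S
    P-nonface : ¬ isClique (λ _ → true) ls P ≡ true
    P-nonface clique with () ← trans (sym incompatible)
      (isClique-compatible _ ls P clique (x∈p∪q⁺ (inj₁ (x∈⁅x⁆ i))) (x∈p∪q⁺ (inj₂ (x∈⁅x⁆ j))))
    S⊆P : S ⊆ P
    S⊆P {x} x∈S with x ∈? P
    ... | yes x∈P = x∈P
    ... | no x∉P = ⊥-elim (P-nonface (minimal P (P⊆S , x , x∈S , x∉P)))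

  cliques : ℕ → List L → ℕ
  cliques zero _ = 1
  cliques (suc i) [] = 0
  cliques (suc i) (l ∷ ls) = cliques (suc i) ls + cliques i (filterᵇ (compatible l) ls)

  count-isClique : ∀ allowed ls i →
    length (filterᵇ (λ S → isClique allowed ls S ∧ (∣ S ∣ ≡ᵇ i)) (allSubsets (length ls)))
      ≡ cliques i (filterᵇ allowed ls)
  count-isClique allowed [] zero = refl
  count-isClique allowed [] (suc i) = refl
  count-isClique allowed (l ∷ ls) i = begin
      length (filterᵇ P (map (outside ∷_) A ++ map (inside ∷_) A))
    ≡⟨ length-filterᵇ-++ P (map (outside ∷_) A) _ ⟩
      length (filterᵇ P (map (outside ∷_) A)) + length (filterᵇ P (map (inside ∷_) A))
    ≡⟨ cong₂ _+_ (length-filterᵇ-map P _ A) (length-filterᵇ-map P _ A) ⟩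
      length (filterᵇ (P ∘ (outside ∷_)) A) + length (filterᵇ (P ∘ (inside ∷_)) A)
    ≡⟨ cong (_+ length (filterᵇ (P ∘ (inside ∷_)) A)) (count-isClique allowed ls i) ⟩
      cliques i (filterᵇ allowed ls) + length (filterᵇ (P ∘ (inside ∷_)) A)
    ≡⟨ containing-l i ⟩
      cliques i (filterᵇ allowed (l ∷ ls))
    ∎
    where
    open ≡-Reasoning
    A = allSubsets (length ls)
    P : Subset (length (l ∷ ls)) → Bool
    P S = isClique allowed (l ∷ ls) S ∧ (∣ S ∣ ≡ᵇ i)
    containing-l : ∀ i → cliques i (filterᵇ allowed ls)
        + length (filterᵇ (λ S → isClique allowed (l ∷ ls) (inside ∷ S) ∧ (suc ∣ S ∣ ≡ᵇ i)) A)
      ≡ cliques i (filterᵇ allowed (l ∷ ls))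
    containing-l i with allowed l
    ... | false = trans (cong (λ xs → cliques i (filterᵇ allowed ls) + length xs) (filterᵇ-false A))
                        (+-identityʳ _)
    containing-l zero | true =
      cong (λ xs → 1 + length xs) (trans (filterᵇ-cong A (λ _ → ∧-zeroʳ _)) (filterᵇ-false A))
    containing-l (suc i) | true = cong (_ +_) (begin
        length (filterᵇ (λ S → isClique (λ v → allowed v ∧ compatible l v) ls S ∧ (∣ S ∣ ≡ᵇ i)) A)
      ≡⟨ count-isClique _ ls i ⟩
        cliques i (filterᵇ (λ v → allowed v ∧ compatible l v) ls)
      ≡⟨ cong (cliques i) (filterᵇ-filterᵇ (compatible l) allowed ls) ⟨
        cliques i (filterᵇ (compatible l) (filterᵇ allowed ls))
      ∎)

  Independent : List L → Set
  Independent = AllPairs (λ u v → compatible u v ≡ false)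

  cliques-++ : ∀ i R rest → Independent R →
    cliques (suc i) (R ++ rest)
      ≡ cliques (suc i) rest + sum (map (λ v → cliques i (filterᵇ (compatible v) rest)) R)
  cliques-++ i [] rest [] = sym (+-identityʳ _)
  cliques-++ i (v ∷ R) rest (v-indep ∷ R-indep) = begin
      cliques (suc i) (R ++ rest) + cliques i (filterᵇ (compatible v) (R ++ rest))
    ≡⟨ cong₂ _+_ (cliques-++ i R rest R-indep) (cong (cliques i) v-neighbours) ⟩
      cliques (suc i) rest + sum (map f R) + f v
    ≡⟨ +-CS.xy∙z≈x∙zy (cliques (suc i) rest) _ _ ⟩
      cliques (suc i) rest + (f v + sum (map f R))
    ∎
    where
    open ≡-Reasoning
    f : L → ℕ
    f v = cliques i (filterᵇ (compatible v) rest)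
    v-neighbours : filterᵇ (compatible v) (R ++ rest) ≡ filterᵇ (compatible v) rest
    v-neighbours = trans (filter-++ (T? ∘ compatible v) R rest)
                         (cong (_++ filterᵇ (compatible v) rest) (filterᵇ-none v-indep))

  cliqueComplex-colouring : ∀ {d} ls → Unique ls → (key : L → ℕ) → All (λ v → key v < d) ls →
    (∀ {u v} → compatible u v ≡ true → key u ≡ key v → u ≡ v) →
    Σ[ κ ∈ (Fin (length ls) → Fin d) ] ∀ F → isFace (cliqueComplex ls) F ≡ true →
      ∀ x y → x ∈ F → y ∈ F → κ x ≡ κ y → x ≡ y
  cliqueComplex-colouring ls unique key key<d separates = κ , proper
    where
    κ : Fin (length ls) → Fin _
    κ x = fromℕ< (All.lookup key<d (∈-lookup x))
    proper : ∀ F → isFace (cliqueComplex ls) F ≡ true → ∀ x y → x ∈ F → y ∈ F → κ x ≡ κ y → x ≡ y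
    proper F face x y x∈F y∈F κx≡κy = lookup-injective unique
      (separates (isClique-compatible _ ls F face x∈F y∈F)
                 (trans (sym (toℕ-fromℕ< _)) (trans (cong toℕ κx≡κy) (toℕ-fromℕ< _))))

-- Finite sums

infixr 8 [_]·_
[_]·_ : Bool → ℕ → ℕ
[ true  ]· n = n
[ false ]· n = 0

[]·-zero : ∀ c → [ c ]· 0 ≡ 0
[]·-zero true  = refl
[]·-zero false = refl

[]·-distrib-+ : ∀ c m n → [ c ]· (m + n) ≡ [ c ]· m + [ c ]· n
[]·-distrib-+ true  m n = refl
[]·-distrib-+ false m n = refl

[]·-comm : ∀ c d n → [ c ]· [ d ]· n ≡ [ d ]· [ c ]· n
[]·-comm true  d n = refl
[]·-comm false d n = sym ([]·-zero d)

[]·-*ˡ : ∀ c m n → [ c ]· (m * n) ≡ m * [ c ]· n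
[]·-*ˡ true  m n = refl
[]·-*ˡ false m n = sym (*-zeroʳ m)

sum-map-filterᵇ : ∀ {A : Set} (p : A → Bool) (f : A → ℕ) xs →
  sum (map f (filterᵇ p xs)) ≡ sum (map (λ x → [ p x ]· f x) xs)
sum-map-filterᵇ p f [] = refl
sum-map-filterᵇ p f (x ∷ xs) with p x
... | true  = cong (f x +_) (sum-map-filterᵇ p f xs)
... | false = sum-map-filterᵇ p f xs

sumFrom : ℕ → ℕ → (ℕ → ℕ) → ℕ
sumFrom m zero g = 0
sumFrom m (suc len) g = g m + sumFrom (suc m) len g

sumFrom-cong : ∀ m len {g h : ℕ → ℕ} → (∀ y → m ≤ y → g y ≡ h y) → sumFrom m len g ≡ sumFrom m len h
sumFrom-cong m zero eq = refl
sumFrom-cong m (suc len) eq =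
  cong₂ _+_ (eq m ≤-refl) (sumFrom-cong (suc m) len (λ y m<y → eq y (<⇒≤ m<y)))

sumFrom-zero : ∀ m len → sumFrom m len (λ _ → 0) ≡ 0
sumFrom-zero m zero = refl
sumFrom-zero m (suc len) = sumFrom-zero (suc m) len

sumFrom-distrib-+ : ∀ m len (g h : ℕ → ℕ) →
  sumFrom m len (λ y → g y + h y) ≡ sumFrom m len g + sumFrom m len h
sumFrom-distrib-+ m zero g h = refl
sumFrom-distrib-+ m (suc len) g h =
  trans (cong (g m + h m +_) (sumFrom-distrib-+ (suc m) len g h)) (+-CS.interchange (g m) (h m) _ _)

sumFrom-[]· : ∀ m len c (g : ℕ → ℕ) → sumFrom m len (λ y → [ c ]· g y) ≡ [ c ]· sumFrom m len g
sumFrom-[]· m zero c g = sym ([]·-zero c)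
sumFrom-[]· m (suc len) c g =
  trans (cong ([ c ]· g m +_) (sumFrom-[]· (suc m) len c g)) (sym ([]·-distrib-+ c (g m) _))

sumAntidiagonal : ℕ → (ℕ → ℕ → ℕ) → ℕ
sumAntidiagonal zero h = h 0 0
sumAntidiagonal (suc n) h = h 0 (suc n) + sumAntidiagonal n (λ k l → h (suc k) l)

sumAntidiagonal-cong : ∀ n {g h : ℕ → ℕ → ℕ} → (∀ k l → k + l ≡ n → g k l ≡ h k l) →
  sumAntidiagonal n g ≡ sumAntidiagonal n h
sumAntidiagonal-cong zero eq = eq 0 0 refl
sumAntidiagonal-cong (suc n) eq =
  cong₂ _+_ (eq 0 (suc n) refl) (sumAntidiagonal-cong n (λ k l k+l≡n → eq (suc k) l (cong suc k+l≡n)))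

sumAntidiagonal-zero : ∀ n → sumAntidiagonal n (λ _ _ → 0) ≡ 0
sumAntidiagonal-zero zero = refl
sumAntidiagonal-zero (suc n) = sumAntidiagonal-zero n

sumAntidiagonal-distrib-+ : ∀ n (g h : ℕ → ℕ → ℕ) →
  sumAntidiagonal n (λ k l → g k l + h k l) ≡ sumAntidiagonal n g + sumAntidiagonal n h
sumAntidiagonal-distrib-+ zero g h = refl
sumAntidiagonal-distrib-+ (suc n) g h =
  trans (cong (g 0 (suc n) + h 0 (suc n) +_)
              (sumAntidiagonal-distrib-+ n (λ k l → g (suc k) l) (λ k l → h (suc k) l)))
        (+-CS.interchange (g 0 (suc n)) (h 0 (suc n)) _ _)

*-distribˡ-sumAntidiagonal : ∀ n c (h : ℕ → ℕ → ℕ) →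
  c * sumAntidiagonal n h ≡ sumAntidiagonal n (λ k l → c * h k l)
*-distribˡ-sumAntidiagonal zero c h = refl
*-distribˡ-sumAntidiagonal (suc n) c h =
  trans (*-distribˡ-+ c (h 0 (suc n)) _)
        (cong (c * h 0 (suc n) +_) (*-distribˡ-sumAntidiagonal n c (λ k l → h (suc k) l)))

[]·-sumAntidiagonal : ∀ n c (h : ℕ → ℕ → ℕ) →
  [ c ]· sumAntidiagonal n h ≡ sumAntidiagonal n (λ k l → [ c ]· h k l)
[]·-sumAntidiagonal zero c h = refl
[]·-sumAntidiagonal (suc n) c h =
  trans ([]·-distrib-+ c (h 0 (suc n)) _)
        (cong ([ c ]· h 0 (suc n) +_) ([]·-sumAntidiagonal n c (λ k l → h (suc k) l)))

sumAntidiagonal-last : ∀ n (h : ℕ → ℕ → ℕ) →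
  sumAntidiagonal (suc n) h ≡ h (suc n) 0 + sumAntidiagonal n (λ k l → h k (suc l))
sumAntidiagonal-last zero h = +-comm (h 0 1) (h 1 0)
sumAntidiagonal-last (suc n) h = begin
    h 0 (2 + n) + sumAntidiagonal (suc n) (λ k l → h (suc k) l)
  ≡⟨ cong (h 0 (2 + n) +_) (sumAntidiagonal-last n (λ k l → h (suc k) l)) ⟩
    h 0 (2 + n) + (h (2 + n) 0 + sumAntidiagonal n (λ k l → h (suc k) (suc l)))
  ≡⟨ +-CS.x∙yz≈y∙xz (h 0 (2 + n)) (h (2 + n) 0) _ ⟩
    h (2 + n) 0 + (h 0 (2 + n) + sumAntidiagonal n (λ k l → h (suc k) (suc l)))
  ∎
  where open ≡-Reasoning

sumFrom-sumAntidiagonal : ∀ m len n (c : ℕ → Bool) (N : ℕ → ℕ → ℕ) (E : ℕ → ℕ → ℕ → ℕ) →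
  sumFrom m len (λ y → [ c y ]· sumAntidiagonal n (λ k l → N k l * E y k l))
    ≡ sumAntidiagonal n (λ k l → N k l * sumFrom m len (λ y → [ c y ]· E y k l))
sumFrom-sumAntidiagonal m zero n c N E =
  sym (trans (sumAntidiagonal-cong n (λ k l _ → *-zeroʳ (N k l))) (sumAntidiagonal-zero n))
sumFrom-sumAntidiagonal m (suc len) n c N E = begin
    [ c m ]· sumAntidiagonal n (λ k l → N k l * E m k l) + sumFrom (suc m) len _
  ≡⟨ cong₂ _+_ ([]·-sumAntidiagonal n (c m) _) (sumFrom-sumAntidiagonal (suc m) len n c N E) ⟩
    sumAntidiagonal n (λ k l → [ c m ]· (N k l * E m k l)) + sumAntidiagonal n (λ k l → N k l * rest k l)
  ≡⟨ sumAntidiagonal-distrib-+ n (λ k l → [ c m ]· (N k l * E m k l)) (λ k l → N k l * rest k l) ⟨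
    sumAntidiagonal n (λ k l → [ c m ]· (N k l * E m k l) + N k l * rest k l)
  ≡⟨ sumAntidiagonal-cong n (λ k l _ → trans (cong (_+ N k l * rest k l) ([]·-*ˡ (c m) (N k l) _))
                                             (sym (*-distribˡ-+ (N k l) _ _))) ⟩
    sumAntidiagonal n (λ k l → N k l * ([ c m ]· E m k l + rest k l))
  ∎
  where
  open ≡-Reasoning
  rest : ℕ → ℕ → ℕ
  rest k l = sumFrom (suc m) len (λ y → [ c y ]· E y k l)

-- Binomial identities

δ : ℕ → ℕ → ℕ
δ zero zero = 1
δ _    _    = 0

shift₁ shift₂ : (ℕ → ℕ → ℕ) → ℕ → ℕ → ℕ
shift₁ f zero    l = 0
shift₁ f (suc k) l = f k l
shift₂ f k zero    = 0
shift₂ f k (suc l) = f k l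

shift₁-cong : ∀ {f g : ℕ → ℕ → ℕ} → (∀ k l → f k l ≡ g k l) → ∀ k l → shift₁ f k l ≡ shift₁ g k l
shift₁-cong eq zero    l = refl
shift₁-cong eq (suc k) l = eq k l

shift₂-cong : ∀ {f g : ℕ → ℕ → ℕ} → (∀ k l → f k l ≡ g k l) → ∀ k l → shift₂ f k l ≡ shift₂ g k l
shift₂-cong eq k zero    = refl
shift₂-cong eq k (suc l) = eq k l

disjointPairs : ℕ → ℕ → ℕ → ℕ
disjointPairs zero k l = δ k l
disjointPairs (suc n) k l = disjointPairs n k l + shift₁ (disjointPairs n) k l + shift₂ (disjointPairs n) k l

sumAntidiagonal-shifts : ∀ n (f g : ℕ → ℕ → ℕ) →
  sumAntidiagonal (suc n) (λ k l → (f k l + shift₁ f k l + shift₂ f k l) * g k l)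
    ≡ sumAntidiagonal (suc n) (λ k l → f k l * g k l)
      + sumAntidiagonal n (λ k l → f k l * (g (suc k) l + g k (suc l)))
sumAntidiagonal-shifts n f g = begin
    sumAntidiagonal (suc n) (λ k l → (f k l + shift₁ f k l + shift₂ f k l) * g k l)
  ≡⟨ sumAntidiagonal-cong (suc n) (λ k l _ → distrib (f k l) (shift₁ f k l) (shift₂ f k l) (g k l)) ⟩
    sumAntidiagonal (suc n) (λ k l → fg k l + s₁g k l + s₂g k l)
  ≡⟨ sumAntidiagonal-distrib-+ (suc n) (λ k l → fg k l + s₁g k l) s₂g ⟩
    sumAntidiagonal (suc n) (λ k l → fg k l + s₁g k l) + sumAntidiagonal (suc n) s₂g
  ≡⟨ cong₂ _+_ (sumAntidiagonal-distrib-+ (suc n) fg s₁g) (sumAntidiagonal-last n s₂g) ⟩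
    sumAntidiagonal (suc n) fg + sumAntidiagonal n (λ k l → f k l * g (suc k) l)
      + sumAntidiagonal n (λ k l → f k l * g k (suc l))
  ≡⟨ +-assoc (sumAntidiagonal (suc n) fg) _ _ ⟩
    sumAntidiagonal (suc n) fg
      + (sumAntidiagonal n (λ k l → f k l * g (suc k) l) + sumAntidiagonal n (λ k l → f k l * g k (suc l)))
  ≡⟨ cong (sumAntidiagonal (suc n) fg +_)
          (trans (sumAntidiagonal-cong n (λ k l _ → *-distribˡ-+ (f k l) (g (suc k) l) (g k (suc l))))
                 (sumAntidiagonal-distrib-+ n _ _)) ⟨
    sumAntidiagonal (suc n) fg + sumAntidiagonal n (λ k l → f k l * (g (suc k) l + g k (suc l)))
  ∎
  where
  open ≡-Reasoning
  fg s₁g s₂g : ℕ → ℕ → ℕ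
  fg k l = f k l * g k l
  s₁g k l = shift₁ f k l * g k l
  s₂g k l = shift₂ f k l * g k l
  distrib : ∀ x y z w → (x + y + z) * w ≡ x * w + y * w + z * w
  distrib = solve-∀

private
  x*1+0+y*1≡[y+x]*1 : ∀ x y → x * 1 + 0 + y * 1 ≡ (y + x) * 1
  x*1+0+y*1≡[y+x]*1 = solve-∀

  x*1+y*1+0≡[y+x]*1 : ∀ x y → x * 1 + y * 1 + 0 ≡ (y + x) * 1
  x*1+y*1+0≡[y+x]*1 = solve-∀

  x[y+z]+wy+wz≡[w+x][y+z] : ∀ x y z w → x * (y + z) + w * y + w * z ≡ (w + x) * (y + z)
  x[y+z]+wy+wz≡[w+x][y+z] = solve-∀

disjointPairs-closed : ∀ n k l → disjointPairs n k l ≡ (n C (k + l)) * ((k + l) C k)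
disjointPairs-closed zero    zero    zero    = refl
disjointPairs-closed zero    zero    (suc l) = refl
disjointPairs-closed zero    (suc k) l       = refl
disjointPairs-closed (suc n) zero    zero    = cong (λ x → x + 0 + 0) (disjointPairs-closed n 0 0)
disjointPairs-closed (suc n) zero    (suc l)
  rewrite disjointPairs-closed n 0 (suc l) | disjointPairs-closed n 0 l =
  trans (x*1+0+y*1≡[y+x]*1 (n C suc l) (n C l)) (cong (_* 1) (nCk+nC[k+1]≡[n+1]C[k+1] n l))
disjointPairs-closed (suc n) (suc k) zero
  rewrite disjointPairs-closed n (suc k) 0 | disjointPairs-closed n k 0 | +-identityʳ k
        | nCn≡1 k | nCn≡1 (suc k) =
  trans (x*1+y*1+0≡[y+x]*1 (n C suc k) (n C k)) (cong (_* 1) (nCk+nC[k+1]≡[n+1]C[k+1] n k))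
disjointPairs-closed (suc n) (suc k) (suc l)
  rewrite disjointPairs-closed n (suc k) (suc l) | disjointPairs-closed n k (suc l)
        | disjointPairs-closed n (suc k) l | +-suc k l = begin
    (n C suc m) * (suc m C suc k) + (n C m) * (m C k) + (n C m) * (m C suc k)
  ≡⟨ cong (λ x → (n C suc m) * x + (n C m) * (m C k) + (n C m) * (m C suc k))
          (nCk+nC[k+1]≡[n+1]C[k+1] m k) ⟨
    (n C suc m) * (m C k + m C suc k) + (n C m) * (m C k) + (n C m) * (m C suc k)
  ≡⟨ x[y+z]+wy+wz≡[w+x][y+z] (n C suc m) (m C k) (m C suc k) (n C m) ⟩
    (n C m + n C suc m) * (m C k + m C suc k)
  ≡⟨ cong₂ _*_ (nCk+nC[k+1]≡[n+1]C[k+1] n m) (nCk+nC[k+1]≡[n+1]C[k+1] m k) ⟩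
    (suc n C suc m) * (suc m C suc k)
  ∎
  where
  open ≡-Reasoning
  m = suc (k + l)

vandermonde : ∀ p q n → sumAntidiagonal n (λ k l → (p C k) * (q C l)) ≡ (p + q) C n
vandermonde zero q zero = +-identityʳ 1
vandermonde zero q (suc n) =
  trans (cong₂ _+_ (+-identityʳ (q C suc n)) (sumAntidiagonal-zero n)) (+-identityʳ (q C suc n))
vandermonde (suc p) q zero = refl
vandermonde (suc p) q (suc n) = begin
    sumAntidiagonal (suc n) (λ k l → (suc p C k) * (q C l))
  ≡⟨ sumAntidiagonal-cong (suc n) (λ k l _ → pascal k l) ⟩
    sumAntidiagonal (suc n) (λ k l → (p C k) * (q C l) + shift₁ (λ k l → (p C k) * (q C l)) k l)
  ≡⟨ sumAntidiagonal-distrib-+ (suc n) (λ k l → (p C k) * (q C l)) (shift₁ (λ k l → (p C k) * (q C l))) ⟩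
    sumAntidiagonal (suc n) (λ k l → (p C k) * (q C l)) + sumAntidiagonal n (λ k l → (p C k) * (q C l))
  ≡⟨ cong₂ _+_ (vandermonde p q (suc n)) (vandermonde p q n) ⟩
    (p + q) C suc n + (p + q) C n
  ≡⟨ +-comm ((p + q) C suc n) _ ⟩
    (p + q) C n + (p + q) C suc n
  ≡⟨ nCk+nC[k+1]≡[n+1]C[k+1] (p + q) n ⟩
    suc (p + q) C suc n
  ∎
  where
  open ≡-Reasoning
  pascal : ∀ k l → (suc p C k) * (q C l) ≡ (p C k) * (q C l) + shift₁ (λ k l → (p C k) * (q C l)) k l
  pascal zero    l = sym (+-identityʳ _)
  pascal (suc k) l = begin
      (suc p C suc k) * (q C l)
    ≡⟨ cong (_* (q C l)) (nCk+nC[k+1]≡[n+1]C[k+1] p k) ⟨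
      (p C k + p C suc k) * (q C l)
    ≡⟨ *-distribʳ-+ (q C l) (p C k) (p C suc k) ⟩
      (p C k) * (q C l) + (p C suc k) * (q C l)
    ≡⟨ +-comm ((p C k) * (q C l)) _ ⟩
      (p C suc k) * (q C l) + (p C k) * (q C l)
    ∎

binomial-sym : ∀ k l → (k + l) C k ≡ (k + l) C l
binomial-sym k l = trans (nCk≡nC[n∸k] (m≤m+n k l)) (cong ((k + l) C_) (m+n∸m≡n k l))

sumAntidiagonal-disjointPairs² : ∀ a b i →
  sumAntidiagonal i (λ k l → disjointPairs a k l * disjointPairs b k l) ≡ coeff a b i
sumAntidiagonal-disjointPairs² a b i = begin
    sumAntidiagonal i (λ k l → disjointPairs a k l * disjointPairs b k l)
  ≡⟨ sumAntidiagonal-cong i factor ⟩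
    sumAntidiagonal i (λ k l → ((a C i) * (b C i)) * ((i C k) * (i C l)))
  ≡⟨ *-distribˡ-sumAntidiagonal i ((a C i) * (b C i)) _ ⟨
    ((a C i) * (b C i)) * sumAntidiagonal i (λ k l → (i C k) * (i C l))
  ≡⟨ cong ((a C i) * (b C i) *_) (vandermonde i i i) ⟩
    ((a C i) * (b C i)) * ((i + i) C i)
  ≡⟨ cong (λ j → ((a C i) * (b C i)) * ((i + j) C i)) (+-identityʳ i) ⟨
    ((a C i) * (b C i)) * ((2 * i) C i)
  ≡⟨ xy∙z≡z∙x∙y (a C i) (b C i) ((2 * i) C i) ⟩
    coeff a b i
  ∎
  where
  open ≡-Reasoning
  xy∙z≡z∙x∙y : ∀ x y z → (x * y) * z ≡ z * x * y
  xy∙z≡z∙x∙y = solve-∀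
  xz∙yw≡xy∙zw : ∀ x y z w → (x * z) * (y * w) ≡ (x * y) * (z * w)
  xz∙yw≡xy∙zw = solve-∀
  factor : ∀ k l → k + l ≡ i →
    disjointPairs a k l * disjointPairs b k l ≡ ((a C i) * (b C i)) * ((i C k) * (i C l))
  factor k l refl = begin
      disjointPairs a k l * disjointPairs b k l
    ≡⟨ cong₂ _*_ (disjointPairs-closed a k l) (disjointPairs-closed b k l) ⟩
      ((a C (k + l)) * ((k + l) C k)) * ((b C (k + l)) * ((k + l) C k))
    ≡⟨ cong (λ x → ((a C (k + l)) * ((k + l) C k)) * ((b C (k + l)) * x)) (binomial-sym k l) ⟩
      ((a C (k + l)) * ((k + l) C k)) * ((b C (k + l)) * ((k + l) C l))
    ≡⟨ xz∙yw≡xy∙zw (a C (k + l)) (b C (k + l)) ((k + l) C k) ((k + l) C l) ⟩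
      ((a C (k + l)) * (b C (k + l))) * (((k + l) C k) * ((k + l) C l))
    ∎

k≤n⇒nCk>0 : ∀ {n k} → k ≤ n → 0 < n C k
k≤n⇒nCk>0 {n} {zero} _ = z<s
k≤n⇒nCk>0 {suc n} {suc k} (s≤s k≤n) =
  subst (0 <_) (nCk+nC[k+1]≡[n+1]C[k+1] n k) (<-≤-trans (k≤n⇒nCk>0 k≤n) (m≤m+n _ _))

coeff-pos : ∀ a b {j} → j ≤ a → j ≤ b → 0 < coeff a b j
coeff-pos a b {j} j≤a j≤b =
  *-mono-< (*-mono-< (k≤n⇒nCk>0 (m≤m+n j _)) (k≤n⇒nCk>0 j≤a)) (k≤n⇒nCk>0 j≤b)

coeff-vanish : ∀ a b {j} → a ⊓ b < j → coeff a b j ≡ 0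
coeff-vanish a b {j} a⊓b<j with ⊓-sel a b
... | inj₁ a⊓b≡a = begin
    ((2 * j) C j) * (a C j) * (b C j)
  ≡⟨ cong (λ x → ((2 * j) C j) * x * (b C j)) (k>n⇒nCk≡0 (subst (_< j) a⊓b≡a a⊓b<j)) ⟩
    ((2 * j) C j) * 0 * (b C j)
  ≡⟨ cong (_* (b C j)) (*-zeroʳ ((2 * j) C j)) ⟩
    0
  ∎
  where open ≡-Reasoning
... | inj₂ a⊓b≡b = begin
    ((2 * j) C j) * (a C j) * (b C j)
  ≡⟨ cong (((2 * j) C j) * (a C j) *_) (k>n⇒nCk≡0 (subst (_< j) a⊓b≡b a⊓b<j)) ⟩
    ((2 * j) C j) * (a C j) * 0
  ≡⟨ *-zeroʳ (((2 * j) C j) * (a C j)) ⟩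
    0
  ∎
  where open ≡-Reasoning

-- The grid complex

≡ᵇ-refl : ∀ n → (n ≡ᵇ n) ≡ true
≡ᵇ-refl zero    = refl
≡ᵇ-refl (suc n) = ≡ᵇ-refl n

<ᵇ-irrefl : ∀ n → (n <ᵇ n) ≡ false
<ᵇ-irrefl zero    = refl
<ᵇ-irrefl (suc n) = <ᵇ-irrefl n

<⇒<ᵇ≡true : ∀ {m n} → m < n → (m <ᵇ n) ≡ true
<⇒<ᵇ≡true {zero}  (s≤s _)   = refl
<⇒<ᵇ≡true {suc m} (s≤s m<n) = <⇒<ᵇ≡true m<n

<⇒>ᵇ≡false : ∀ {m n} → m < n → (n <ᵇ m) ≡ false
<⇒>ᵇ≡false {zero}  (s≤s _)   = refl
<⇒>ᵇ≡false {suc m} (s≤s m<n) = <⇒>ᵇ≡false m<n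

<⇒≡ᵇ≡false : ∀ {m n} → m < n → (m ≡ᵇ n) ≡ false
<⇒≡ᵇ≡false {zero}  (s≤s _)   = refl
<⇒≡ᵇ≡false {suc m} (s≤s m<n) = <⇒≡ᵇ≡false m<n

>⇒≡ᵇ≡false : ∀ {m n} → m < n → (n ≡ᵇ m) ≡ false
>⇒≡ᵇ≡false {zero}  (s≤s _)   = refl
>⇒≡ᵇ≡false {suc m} (s≤s m<n) = >⇒≡ᵇ≡false m<n

record Cell : Set where
  constructor cell
  field
    row column : ℕ
    tag : Bool
open Cell

-- Compatibility of a cell in column y with tag s and a cell in column y' with tag s' lying in a
-- strictly later row: the columns differ, and cells of equal tag must go right.
laterCompatible : ℕ → Bool → ℕ → Bool → Bool
laterCompatible y s y' s' = not (y ≡ᵇ y') ∧ ((y <ᵇ y') ∨ (s xor s'))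

-- A pair is judged from its cell in the earlier row; conjoining both orders makes compatible symmetric.
compatibleFrom : Cell → Cell → Bool
compatibleFrom (cell x y s) (cell x' y' s') =
  if x <ᵇ x' then laterCompatible y s y' s'
  else if x' <ᵇ x then true
  else (y ≡ᵇ y') ∧ not (s xor s')

compatible : Cell → Cell → Bool
compatible u v = compatibleFrom u v ∧ compatibleFrom v u

laterCompatible-sameColumn : ∀ y s s' → laterCompatible y s y s' ≡ false
laterCompatible-sameColumn y s s' rewrite ≡ᵇ-refl y = refl

laterCompatible-< : ∀ {y y'} s s' → y < y' → laterCompatible y s y' s' ≡ true
laterCompatible-< s s' y<y' rewrite <⇒≡ᵇ≡false y<y' | <⇒<ᵇ≡true y<y' = refl

laterCompatible-> : ∀ {y y'} s s' → y' < y → laterCompatible y s y' s' ≡ s xor s'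
laterCompatible-> s s' y'<y rewrite >⇒≡ᵇ≡false y'<y | <⇒>ᵇ≡false y'<y = refl

compatible-refl : ∀ u → compatible u u ≡ true
compatible-refl (cell x y s) rewrite <ᵇ-irrefl x | ≡ᵇ-refl y | xor-same s = refl

compatible-sym : ∀ u v → compatible u v ≡ compatible v u
compatible-sym u v = ∧-comm (compatibleFrom u v) (compatibleFrom v u)

compatible-< : ∀ {x x'} y s y' s' → x < x' → compatible (cell x y s) (cell x' y' s') ≡ laterCompatible y s y' s'
compatible-< y s y' s' x<x' rewrite <⇒<ᵇ≡true x<x' | <⇒>ᵇ≡false x<x' = ∧-identityʳ _

compatible-sameRow : ∀ {u v} → compatible u v ≡ true → row u ≡ row v → u ≡ v
compatible-sameRow {cell x y s} {cell .x y' s'} compat refl rewrite <ᵇ-irrefl x =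
  cong₂ (cell x) (≡ᵇ⇒≡ y y' (subst T (sym (∧-elimˡ sameCell)) _)) (sameTag s s' (∧-elimʳ sameCell))
  where
  sameCell : (y ≡ᵇ y') ∧ not (s xor s') ≡ true
  sameCell = ∧-elimˡ compat
  sameTag : ∀ s s' → not (s xor s') ≡ true → s ≡ s'
  sameTag true  true  _ = refl
  sameTag false false _ = refl

compatible-sameColumn : ∀ {u v} → compatible u v ≡ true → column u ≡ column v → u ≡ v
compatible-sameColumn {cell x y s} {cell x' .y s'} compat refl with <-cmp x x'
... | tri< x<x' _ _ with () ← trans (sym compat)
                               (trans (compatible-< y s y s' x<x') (laterCompatible-sameColumn y s s'))
... | tri> _ _ x'<x with () ← trans (sym compat) (trans (compatible-sym (cell x y s) _)
                              (trans (compatible-< y s' y s x'<x) (laterCompatible-sameColumn y s' s)))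
... | tri≈ _ x≡x' _ = compatible-sameRow compat x≡x'

open CliqueComplex compatible compatible-refl compatible-sym

distinct⇒incompatible : ∀ {u v} → row u ≡ row v → u ≢ v → compatible u v ≡ false
distinct⇒incompatible {u} {v} sameRow u≢v with compatible u v in compat
... | true  = ⊥-elim (u≢v (compatible-sameRow compat sameRow))
... | false = refl

sameRow-independent : ∀ {x zs} → All (λ z → row z ≡ x) zs → Unique zs → Independent zs
sameRow-independent [] [] = []
sameRow-independent (rz ∷ rzs) (z∉zs ∷ unique) =
  All.zipWith (λ (rw , z≢w) → distinct⇒incompatible (trans rz (sym rw)) z≢w) (rzs , z∉zs)
  ∷ sameRow-independent rzs unique

rowCells : ℕ → ℕ → ℕ → List Cell
rowCells x m zero = []
rowCells x m (suc len) = cell x m false ∷ cell x m true ∷ rowCells x (suc m) len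

gridFrom : ℕ → ℕ → ℕ → List Cell
gridFrom x zero    b = []
gridFrom x (suc a) b = rowCells x 0 b ++ gridFrom (suc x) a b

rowCells-bounds : ∀ x m len →
  All (λ z → row z ≡ x × m ≤ column z × column z < m + len) (rowCells x m len)
rowCells-bounds x m zero = []
rowCells-bounds x m (suc len) = first ∷ first ∷ All.map (λ {z} → later {z}) (rowCells-bounds x (suc m) len)
  where
  first : x ≡ x × m ≤ m × m < m + suc len
  first = refl , ≤-refl , m<m+n m z<s
  later : ∀ {z} → row z ≡ x × m < column z × column z < suc m + len →
    row z ≡ x × m ≤ column z × column z < m + suc len
  later {z} (r , m<c , c<) = r , <⇒≤ m<c , subst (column z <_) (sym (+-suc m len)) c<

gridFrom-bounds : ∀ x a b → All (λ z → x ≤ row z × row z < x + a × column z < b) (gridFrom x a b)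
gridFrom-bounds x zero b = []
gridFrom-bounds x (suc a) b =
  Allₚ.++⁺ (All.map (λ {z} → inFirstRow {z}) (rowCells-bounds x 0 b))
           (All.map (λ {z} → inLaterRow {z}) (gridFrom-bounds (suc x) a b))
  where
  inFirstRow : ∀ {z} → row z ≡ x × 0 ≤ column z × column z < b → x ≤ row z × row z < x + suc a × column z < b
  inFirstRow (r , _ , c<b) = ≤-reflexive (sym r) , subst (_< x + suc a) (sym r) (m<m+n x z<s) , c<b
  inLaterRow : ∀ {z} → x < row z × row z < suc x + a × column z < b →
    x ≤ row z × row z < x + suc a × column z < b
  inLaterRow {z} (x<r , r< , c<b) = <⇒≤ x<r , subst (row z <_) (sym (+-suc x a)) r< , c<b

rowCells-unique : ∀ x m len → Unique (rowCells x m len)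
rowCells-unique x m zero = []
rowCells-unique x m (suc len) =
  ((λ ()) ∷ All.map (laterColumn false) bounds) ∷ All.map (laterColumn true) bounds
  ∷ rowCells-unique x (suc m) len
  where
  bounds = rowCells-bounds x (suc m) len
  laterColumn : ∀ s {z} → row z ≡ x × m < column z × column z < suc m + len → cell x m s ≢ z
  laterColumn _ (_ , m<c , _) eq = <⇒≢ m<c (cong column eq)

gridFrom-unique : ∀ x a b → Unique (gridFrom x a b)
gridFrom-unique x zero b = []
gridFrom-unique x (suc a) b =
  AllPairsₚ.++⁺ (rowCells-unique x 0 b) (gridFrom-unique (suc x) a b)
    (All.map (λ (ru , _) → All.map (λ (x<rv , _) u≡v → <⇒≢ x<rv (trans (sym ru) (cong row u≡v)))
                                   (gridFrom-bounds (suc x) a b))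
             (rowCells-bounds x 0 b))

-- Counting the faces of the grid complex

Allowed : Set
Allowed = ℕ → Bool → Bool

allowedCell : Allowed → Cell → Bool
allowedCell A z = A (column z) (tag z)

restrictAfter : Allowed → ℕ → Bool → Allowed
restrictAfter A y s y' s' = laterCompatible y s y' s' ∧ A y' s'

swapTags : Allowed → Allowed
swapTags A y s = A y (not s)

-- The number of pairs (K , L) of disjoint sets of columns in [m, m + len) with |K| = k, |L| = l,
-- such that A y false for y ∈ K and A y true for y ∈ L.
allowedPairs : Allowed → ℕ → ℕ → ℕ → ℕ → ℕ
allowedPairs A m zero k l = δ k l
allowedPairs A m (suc len) k l =
  P k l + [ A m false ]· shift₁ P k l + [ A m true ]· shift₂ P k l
  where P = allowedPairs A (suc m) len

allowedPairs-cong : ∀ {A A'} m len → (∀ y s → m ≤ y → A y s ≡ A' y s) →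
  ∀ k l → allowedPairs A m len k l ≡ allowedPairs A' m len k l
allowedPairs-cong m zero eq k l = refl
allowedPairs-cong {A} {A'} m (suc len) eq k l rewrite eq m false ≤-refl | eq m true ≤-refl =
  cong₂ _+_ (cong₂ _+_ (IH k l) (cong ([ A' m false ]·_) (shift₁-cong IH k l)))
            (cong ([ A' m true ]·_) (shift₂-cong IH k l))
  where IH = allowedPairs-cong (suc m) len (λ y s m<y → eq y s (<⇒≤ m<y))

allowedPairs-swapTags : ∀ A m len k l → allowedPairs (swapTags A) m len k l ≡ allowedPairs A m len l k
allowedPairs-swapTags A m zero zero    zero    = refl
allowedPairs-swapTags A m zero zero    (suc l) = refl
allowedPairs-swapTags A m zero (suc k) zero    = refl
allowedPairs-swapTags A m zero (suc k) (suc l) = refl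
allowedPairs-swapTags A m (suc len) k l = begin
    P' k l + [ A m true ]· shift₁ P' k l + [ A m false ]· shift₂ P' k l
  ≡⟨ cong₂ _+_ (cong₂ _+_ (IH k l) (cong ([ A m true ]·_) (swap₁ k))) (cong ([ A m false ]·_) (swap₂ l)) ⟩
    P l k + [ A m true ]· shift₂ P l k + [ A m false ]· shift₁ P l k
  ≡⟨ +-CS.xy∙z≈xz∙y (P l k) _ _ ⟩
    P l k + [ A m false ]· shift₁ P l k + [ A m true ]· shift₂ P l k
  ∎
  where
  open ≡-Reasoning
  P' = allowedPairs (swapTags A) (suc m) len
  P = allowedPairs A (suc m) len
  IH = allowedPairs-swapTags A (suc m) len
  swap₁ : ∀ k → shift₁ P' k l ≡ shift₂ P l k
  swap₁ zero    = refl
  swap₁ (suc k) = IH k l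
  swap₂ : ∀ l → shift₂ P' k l ≡ shift₁ P l k
  swap₂ zero    = refl
  swap₂ (suc l) = IH k l

allowedPairs-all : ∀ m len k l → allowedPairs (λ _ _ → true) m len k l ≡ disjointPairs len k l
allowedPairs-all m zero k l = refl
allowedPairs-all m (suc len) k l =
  cong₂ _+_ (cong₂ _+_ (IH k l) (shift₁-cong IH k l)) (shift₂-cong IH k l)
  where IH = allowedPairs-all (suc m) len

allowedPairs-zero : ∀ A m len → allowedPairs A m len 0 0 ≡ 1
allowedPairs-zero A m zero = refl
allowedPairs-zero A m (suc len)
  rewrite allowedPairs-zero A (suc m) len | []·-zero (A m false) | []·-zero (A m true) = refl

-- Split the pairs (K , L) according to the least element y of K: the rest of K lies after y,
-- and L avoids y.
allowedPairs-least₁ : ∀ A m len k l →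
  allowedPairs A m len (suc k) l
    ≡ sumFrom m len (λ y → [ A y false ]· allowedPairs (restrictAfter A y false) m len k l)
allowedPairs-least₁ A m zero k l = refl
allowedPairs-least₁ A m (suc len) k l = begin
    P (suc k) l + [ A m false ]· P k l + [ A m true ]· shift₂ P (suc k) l
  ≡⟨ +-CS.xy∙z≈y∙xz (P (suc k) l) _ _ ⟩
    [ A m false ]· P k l + (P (suc k) l + [ A m true ]· shift₂ P (suc k) l)
  ≡⟨ cong₂ _+_ (cong ([ A m false ]·_) least-is-m) least-after-m ⟨
    [ A m false ]· allowedPairs (restrictAfter A m false) m (suc len) k l
      + sumFrom (suc m) len (λ y → [ A y false ]· allowedPairs (restrictAfter A y false) m (suc len) k l)
  ∎
  where
  open ≡-Reasoning
  P = allowedPairs A (suc m) len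
  E : ℕ → ℕ → ℕ → ℕ
  E y = allowedPairs (restrictAfter A y false) (suc m) len
  IH = allowedPairs-least₁ A (suc m) len
  least-is-m : allowedPairs (restrictAfter A m false) m (suc len) k l ≡ P k l
  least-is-m rewrite laterCompatible-sameColumn m false false | laterCompatible-sameColumn m false true =
    trans (+-identityʳ _) (trans (+-identityʳ _)
      (allowedPairs-cong (suc m) len (λ y s m<y → cong (_∧ A y s) (laterCompatible-< false s m<y)) k l))
  least-after : ∀ y → m < y → [ A y false ]· allowedPairs (restrictAfter A y false) m (suc len) k l
    ≡ [ A y false ]· E y k l + [ A m true ]· [ A y false ]· shift₂ (E y) k l
  least-after y m<y
    rewrite laterCompatible-> false false m<y | laterCompatible-> false true m<y | +-identityʳ (E y k l) =
    trans ([]·-distrib-+ (A y false) (E y k l) _)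
          (cong ([ A y false ]· E y k l +_) ([]·-comm (A y false) (A m true) _))
  shifted : ∀ l → sumFrom (suc m) len (λ y → [ A y false ]· shift₂ (E y) k l) ≡ shift₂ P (suc k) l
  shifted zero    = trans (sumFrom-cong (suc m) len (λ y _ → []·-zero (A y false))) (sumFrom-zero (suc m) len)
  shifted (suc l) = sym (IH k l)
  least-after-m :
    sumFrom (suc m) len (λ y → [ A y false ]· allowedPairs (restrictAfter A y false) m (suc len) k l)
      ≡ P (suc k) l + [ A m true ]· shift₂ P (suc k) l
  least-after-m = begin
      sumFrom (suc m) len (λ y → [ A y false ]· allowedPairs (restrictAfter A y false) m (suc len) k l)
    ≡⟨ sumFrom-cong (suc m) len least-after ⟩
      sumFrom (suc m) len (λ y → [ A y false ]· E y k l + [ A m true ]· [ A y false ]· shift₂ (E y) k l)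
    ≡⟨ sumFrom-distrib-+ (suc m) len _ _ ⟩
      sumFrom (suc m) len (λ y → [ A y false ]· E y k l)
        + sumFrom (suc m) len (λ y → [ A m true ]· [ A y false ]· shift₂ (E y) k l)
    ≡⟨ cong₂ _+_ (sym (IH k l))
                 (trans (sumFrom-[]· (suc m) len (A m true) _) (cong ([ A m true ]·_) (shifted l))) ⟩
      P (suc k) l + [ A m true ]· shift₂ P (suc k) l
    ∎

allowedPairs-least₂ : ∀ A m len k l →
  allowedPairs A m len k (suc l)
    ≡ sumFrom m len (λ y → [ A y true ]· allowedPairs (restrictAfter A y true) m len k l)
allowedPairs-least₂ A m len k l = begin
    allowedPairs A m len k (suc l)
  ≡⟨ allowedPairs-swapTags A m len (suc l) k ⟨
    allowedPairs (swapTags A) m len (suc l) k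
  ≡⟨ allowedPairs-least₁ (swapTags A) m len l k ⟩
    sumFrom m len (λ y → [ A y true ]· allowedPairs (restrictAfter (swapTags A) y false) m len l k)
  ≡⟨ sumFrom-cong m len (λ y _ → cong ([ A y true ]·_) (swapped y)) ⟩
    sumFrom m len (λ y → [ A y true ]· allowedPairs (restrictAfter A y true) m len k l)
  ∎
  where
  open ≡-Reasoning
  flip-tags : ∀ y y' s' → laterCompatible y false y' s' ≡ laterCompatible y true y' (not s')
  flip-tags y y' true  = refl
  flip-tags y y' false = refl
  swapped : ∀ y → allowedPairs (restrictAfter (swapTags A) y false) m len l k
                ≡ allowedPairs (restrictAfter A y true) m len k l
  swapped y = trans (allowedPairs-cong m len (λ y' s' _ → cong (_∧ A y' (not s')) (flip-tags y y' s')) l k)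
                    (allowedPairs-swapTags (restrictAfter A y true) m len l k)

sum-rowCells : ∀ (g : Cell → ℕ) x m len →
  sum (map g (rowCells x m len)) ≡ sumFrom m len (λ y → g (cell x y false) + g (cell x y true))
sum-rowCells g x m zero = refl
sum-rowCells g x m (suc len) =
  trans (cong (λ r → g (cell x m false) + (g (cell x m true) + r)) (sum-rowCells g x (suc m) len))
        (sym (+-assoc (g (cell x m false)) _ _))

neighbours : ∀ A x a b y s →
  filterᵇ (compatible (cell x y s)) (filterᵇ (allowedCell A) (gridFrom (suc x) a b))
    ≡ filterᵇ (allowedCell (restrictAfter A y s)) (gridFrom (suc x) a b)
neighbours A x a b y s =
  trans (filterᵇ-filterᵇ (compatible (cell x y s)) (allowedCell A) (gridFrom (suc x) a b))
        (filterᵇ-cong-All (gridFrom-bounds (suc x) a b) later)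
  where
  later : ∀ {z} → suc x ≤ row z × _ →
    allowedCell A z ∧ compatible (cell x y s) z ≡ allowedCell (restrictAfter A y s) z
  later {cell x' y' s'} (x<x' , _) =
    trans (cong (A y' s' ∧_) (compatible-< y s y' s' x<x')) (∧-comm (A y' s') _)

-- Peeling off the first row: a clique uses at most one cell of it, and that cell is the least
-- element of its tag class among the chosen columns.
cliques-restrictedGrid : ∀ A x a b i →
  cliques i (filterᵇ (allowedCell A) (gridFrom x a b))
    ≡ sumAntidiagonal i (λ k l → disjointPairs a k l * allowedPairs A 0 b k l)
cliques-restrictedGrid A x zero b zero = sym (trans (+-identityʳ _) (allowedPairs-zero A 0 b))
cliques-restrictedGrid A x zero b (suc i) = sym (sumAntidiagonal-zero i)
cliques-restrictedGrid A x (suc a) b zero =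
  sym (cong₂ _*_ (disjointPairs-closed (suc a) 0 0) (allowedPairs-zero A 0 b))
cliques-restrictedGrid A x (suc a) b (suc i) = begin
    cliques (suc i) (filterᵇ (allowedCell A) (rowCells x 0 b ++ gridFrom (suc x) a b))
  ≡⟨ cong (cliques (suc i)) (filter-++ (T? ∘ allowedCell A) (rowCells x 0 b) _) ⟩
    cliques (suc i) (R ++ rest)
  ≡⟨ cliques-++ i R rest R-independent ⟩
    cliques (suc i) rest + sum (map f R)
  ≡⟨ cong₂ _+_ (cliques-restrictedGrid A (suc x) a b (suc i)) firstRow ⟩
    sumAntidiagonal (suc i) (λ k l → N k l * D k l)
      + sumAntidiagonal i (λ k l → N k l * (D (suc k) l + D k (suc l)))
  ≡⟨ sumAntidiagonal-shifts i N D ⟨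
    sumAntidiagonal (suc i) (λ k l → disjointPairs (suc a) k l * D k l)
  ∎
  where
  open ≡-Reasoning
  R = filterᵇ (allowedCell A) (rowCells x 0 b)
  rest = filterᵇ (allowedCell A) (gridFrom (suc x) a b)
  N = disjointPairs a
  D = allowedPairs A 0 b
  f : Cell → ℕ
  f v = cliques i (filterᵇ (compatible v) rest)
  R-independent : Independent R
  R-independent = AllPairsₚ.filter⁺ (T? ∘ allowedCell A)
    (sameRow-independent (All.map proj₁ (rowCells-bounds x 0 b)) (rowCells-unique x 0 b))
  chosen : Bool → ℕ → ℕ → ℕ
  chosen s k l = sumFrom 0 b (λ y → [ A y s ]· allowedPairs (restrictAfter A y s) 0 b k l)
  byTag : ∀ s → sumFrom 0 b (λ y → [ A y s ]· f (cell x y s))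
    ≡ sumAntidiagonal i (λ k l → N k l * chosen s k l)
  byTag s = trans
    (sumFrom-cong 0 b (λ y _ → cong ([ A y s ]·_)
      (trans (cong (cliques i) (neighbours A x a b y s))
             (cliques-restrictedGrid (restrictAfter A y s) (suc x) a b i))))
    (sumFrom-sumAntidiagonal 0 b i (λ y → A y s) N (λ y → allowedPairs (restrictAfter A y s) 0 b))
  firstRow : sum (map f R) ≡ sumAntidiagonal i (λ k l → N k l * (D (suc k) l + D k (suc l)))
  firstRow = begin
      sum (map f R)
    ≡⟨ sum-map-filterᵇ (allowedCell A) f (rowCells x 0 b) ⟩
      sum (map (λ v → [ allowedCell A v ]· f v) (rowCells x 0 b))
    ≡⟨ sum-rowCells _ x 0 b ⟩
      sumFrom 0 b (λ y → [ A y false ]· f (cell x y false) + [ A y true ]· f (cell x y true))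
    ≡⟨ sumFrom-distrib-+ 0 b _ _ ⟩
      sumFrom 0 b (λ y → [ A y false ]· f (cell x y false))
        + sumFrom 0 b (λ y → [ A y true ]· f (cell x y true))
    ≡⟨ cong₂ _+_ (byTag false) (byTag true) ⟩
      sumAntidiagonal i (λ k l → N k l * chosen false k l) + sumAntidiagonal i (λ k l → N k l * chosen true k l)
    ≡⟨ cong₂ _+_ (sumAntidiagonal-cong i (λ k l _ → cong (N k l *_) (allowedPairs-least₁ A 0 b k l)))
                 (sumAntidiagonal-cong i (λ k l _ → cong (N k l *_) (allowedPairs-least₂ A 0 b k l))) ⟨
      sumAntidiagonal i (λ k l → N k l * D (suc k) l) + sumAntidiagonal i (λ k l → N k l * D k (suc l))
    ≡⟨ trans (sumAntidiagonal-cong i (λ k l _ → *-distribˡ-+ (N k l) _ _)) (sumAntidiagonal-distrib-+ i _ _) ⟨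
      sumAntidiagonal i (λ k l → N k l * (D (suc k) l + D k (suc l)))
    ∎

fCoeff-grid : ∀ a b i → fCoeff (cliqueComplex (gridFrom 0 a b)) i ≡ coeff a b i
fCoeff-grid a b i = begin
    fCoeff (cliqueComplex (gridFrom 0 a b)) i
  ≡⟨ count-isClique (λ _ → true) (gridFrom 0 a b) i ⟩
    cliques i (filterᵇ (allowedCell (λ _ _ → true)) (gridFrom 0 a b))
  ≡⟨ cliques-restrictedGrid (λ _ _ → true) 0 a b i ⟩
    sumAntidiagonal i (λ k l → disjointPairs a k l * allowedPairs (λ _ _ → true) 0 b k l)
  ≡⟨ sumAntidiagonal-cong i (λ k l _ → cong (disjointPairs a k l *_) (allowedPairs-all 0 b k l)) ⟩
    sumAntidiagonal i (λ k l → disjointPairs a k l * disjointPairs b k l)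
  ≡⟨ sumAntidiagonal-disjointPairs² a b i ⟩
    coeff a b i
  ∎
  where open ≡-Reasoning

grid-colouring : ∀ a b →
  Σ[ κ ∈ (Fin (length (gridFrom 0 a b)) → Fin (a ⊓ b)) ]
    ∀ F → isFace (cliqueComplex (gridFrom 0 a b)) F ≡ true → ∀ x y → x ∈ F → y ∈ F → κ x ≡ κ y → x ≡ y
grid-colouring a b with ≤-total a b
... | inj₁ a≤b = cliqueComplex-colouring (gridFrom 0 a b) (gridFrom-unique 0 a b) row
  (All.map (λ (_ , r<a , _) → ⊓-glb r<a (≤-trans r<a a≤b)) (gridFrom-bounds 0 a b)) compatible-sameRow
... | inj₂ b≤a = cliqueComplex-colouring (gridFrom 0 a b) (gridFrom-unique 0 a b) column
  (All.map (λ (_ , _ , c<b) → ⊓-glb (≤-trans c<b b≤a) c<b) (gridFrom-bounds 0 a b)) compatible-sameColumn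

-- The construction works for all a and b.
proposition4p13 : (a b : ℕ) → a ≥ 1 → b ≥ 1 →
    Σ[ n ∈ ℕ ] Σ[ K ∈ SimplicialComplex n ]
      IsFlag K × IsBalanced K × (∀ i → fCoeff K i ≡ coeff a b i)
proposition4p13 a b _ _ =
    length G , cliqueComplex G , cliqueComplex-isFlag G
  , fVector⇒isBalanced (cliqueComplex G) (a ⊓ b) top-face above-top (grid-colouring a b)
  , fCoeff-grid a b
  where
  G = gridFrom 0 a b
  top-face : 0 < fCoeff (cliqueComplex G) (a ⊓ b)
  top-face = subst (0 <_) (sym (fCoeff-grid a b (a ⊓ b))) (coeff-pos a b (m⊓n≤m a b) (m⊓n≤n a b))
  above-top : ∀ j → a ⊓ b < j → fCoeff (cliqueComplex G) j ≡ 0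
  above-top j a⊓b<j = trans (fCoeff-grid a b j) (coeff-vanish a b a⊓b<j)
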